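{- Let $E$ be a finite set and let $\operatorname{Shade}:\mathcal{P}(E)\to\mathcal{P}(E)$ be an inclusion-reversing shade map. Define $\tau:\mathcal{P}(E)\to\mathcal{P}(E)$ by $\tau(F)=F\cup(E\setminus\operatorname{Shade}F)$ for each $F\subseteq E$. Then $\tau$ is an antimatroidal quasi-closure operator on $E$.
   Context: $\mathcal{P}(E)$ is the power set of $E$. A map $S:\mathcal{P}(E)\to\mathcal{P}(E)$ is inclusion-reversing if $A\subseteq B$ implies $S(B)\subseteq S(A)$. A shade map on $E$ is a map $S:\mathcal{P}(E)\to\mathcal{P}(E)$ such that for every $F\subseteq E$ and every $u\in E\setminus S(F)$ we have $S(F\cup\{u\})=S(F)$ and $S(F\setminus\{u\})=S(F)$. A quasi-closure operator on $E$ is a map $\tau:\mathcal{P}(E)\to\mathcal{P}(E)$ with (1) $A\subseteq\tau(A)$ for all $A$; (2) $A\subseteq B$ implies $\tau(A)\subseteq\tau(B)$; (3) $\tau(\tau(A))=\tau(A)$ for all $A$. It is antimatroidal if whenever $X\subseteq E$ and $y,z$ are distinct elements of $E\setminus\tau(X)$ with $z\in\tau(X\cup\{y\})$, then $y\notin\tau(X\cup\{z\})$. -}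

module Defs where

open import Data.Nat using (ℕ)
open import Data.Fin using (Fin)
open import Data.Fin.Subset using (Subset; _∈_; _∉_; _⊆_; _∪_; ∁; ⁅_⁆; _-_)
open import Data.Product using (_×_)
open import Relation.Binary.PropositionalEquality using (_≡_; _≢_)

-- The finite set E is modelled as Fin n; P(E) is Subset n.

InclusionReversing : {n : ℕ} → (Subset n → Subset n) → Set
InclusionReversing {n} S = (A B : Subset n) → A ⊆ B → S B ⊆ S A

IsShadeMap : {n : ℕ} → (Subset n → Subset n) → Set
IsShadeMap {n} S = (F : Subset n) (u : Fin n) → u ∉ S F →
  (S (F ∪ ⁅ u ⁆) ≡ S F) × (S (F - u) ≡ S F)

IsQuasiClosure : {n : ℕ} → (Subset n → Subset n) → Set
IsQuasiClosure {n} τ =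
  ((A : Subset n) → A ⊆ τ A) ×
  ((A B : Subset n) → A ⊆ B → τ A ⊆ τ B) ×
  ((A : Subset n) → τ (τ A) ≡ τ A)

IsAntimatroidal : {n : ℕ} → (Subset n → Subset n) → Set
IsAntimatroidal {n} τ = (X : Subset n) (y z : Fin n) → y ≢ z →
  y ∉ τ X → z ∉ τ X → z ∈ τ (X ∪ ⁅ y ⁆) → y ∉ τ (X ∪ ⁅ z ⁆)

tauOf : {n : ℕ} → (Subset n → Subset n) → Subset n → Subset n
tauOf S F = F ∪ ∁ (S F)

{-# OPTIONS --safe #-}
module Submission where

-- The key fact is that Shade is constant on every interval [F, τ F]: an element of
-- B \ F with F ⊆ B ⊆ τ F lies outside Shade F ⊇ Shade B, so removing it from B does
-- not change the shade, and induction on B reaches F. This gives idempotence, and it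
-- also shows Shade (X ∪ {y}) = Shade (X ∪ {z}) whenever each of y, z lies in the
-- closure of X plus the other. For the antimatroid property, z would then lie outside
-- Shade (X ∪ {z}), hence (removing z) outside Shade X, i.e. z ∈ τ X.

open import Defs
open import Data.Nat using (ℕ)
open import Data.Fin using (Fin; zero; suc)
open import Data.Fin.Properties using (any?)
open import Data.Fin.Subset
open import Data.Fin.Subset.Properties
open import Data.Fin.Subset.Induction using (Acc; acc; ⊂-wellFounded)
open import Data.Product using (_×_; _,_; proj₂)
open import Data.Sum using (inj₁; inj₂)
open import Data.Vec using (_∷_; here; there)
open import Function using (_∘_)
open import Relation.Nullary using (yes; no; ¬?; _×-dec_)
open import Relation.Nullary.Decidable using (decidable-stable)
open import Relation.Nullary.Negation using (contradiction)
open import Relation.Binary.PropositionalEquality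

∪-lub : ∀ {n} {p q r : Subset n} → p ⊆ r → q ⊆ r → p ∪ q ⊆ r
∪-lub {p = p} {q} p⊆r q⊆r x∈p∪q with x∈p∪q⁻ p q x∈p∪q
... | inj₁ x∈p = p⊆r x∈p
... | inj₂ x∈q = q⊆r x∈q

x∈p⇒⁅x⁆⊆p : ∀ {n} {x : Fin n} {p : Subset n} → x ∈ p → ⁅ x ⁆ ⊆ p
x∈p⇒⁅x⁆⊆p {x = x} {p} x∈p y∈⁅x⁆ = subst (_∈ p) (sym (x∈⁅y⁆⇒x≡y x y∈⁅x⁆)) x∈p

x∉p⇒p∪⁅x⁆-x≡p : ∀ {n} (p : Subset n) (x : Fin n) → x ∉ p → (p ∪ ⁅ x ⁆) - x ≡ p
x∉p⇒p∪⁅x⁆-x≡p (outside ∷ p) zero    _   = cong (outside ∷_) (trans (p─⊥≡p (p ∪ ⊥)) (∪-identityʳ p))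
x∉p⇒p∪⁅x⁆-x≡p (inside  ∷ p) zero    x∉p = contradiction here x∉p
x∉p⇒p∪⁅x⁆-x≡p (outside ∷ p) (suc x) x∉p = cong (outside ∷_) (x∉p⇒p∪⁅x⁆-x≡p p x (x∉p ∘ there))
x∉p⇒p∪⁅x⁆-x≡p (inside  ∷ p) (suc x) x∉p = cong (inside ∷_) (x∉p⇒p∪⁅x⁆-x≡p p x (x∉p ∘ there))

module _ {n : ℕ} (S : Subset n → Subset n) where

  τ : Subset n → Subset n
  τ = tauOf S

  τ-extensive : (A : Subset n) → A ⊆ τ A
  τ-extensive A = p⊆p∪q (∁ (S A))

  ∉S⇒∈τ : ∀ {x F} → x ∉ S F → x ∈ τ F
  ∉S⇒∈τ x∉SF = x∈p∪q⁺ (inj₂ (x∉p⇒x∈∁p x∉SF))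

  ∉τ⇒∉ : ∀ {x F} → x ∉ τ F → x ∉ F
  ∉τ⇒∉ {F = F} x∉τF = x∉τF ∘ τ-extensive F

  ∉τ⇒∈S : ∀ {x F} → x ∉ τ F → x ∈ S F
  ∉τ⇒∈S x∉τF = x∉∁p⇒x∈p (x∉τF ∘ x∈p∪q⁺ ∘ inj₂)

  ∈τ∧∉⇒∉S : ∀ {x F} → x ∈ τ F → x ∉ F → x ∉ S F
  ∈τ∧∉⇒∉S {F = F} x∈τF x∉F with x∈p∪q⁻ F (∁ (S F)) x∈τF
  ... | inj₁ x∈F  = contradiction x∈F x∉F
  ... | inj₂ x∈∁S = x∈∁p⇒x∉p x∈∁S

  x∈τ[p∪⁅y⁆]⇒p∪⁅x⁆⊆τ[p∪⁅y⁆] : ∀ {x y p} → x ∈ τ (p ∪ ⁅ y ⁆) → p ∪ ⁅ x ⁆ ⊆ τ (p ∪ ⁅ y ⁆)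
  x∈τ[p∪⁅y⁆]⇒p∪⁅x⁆⊆τ[p∪⁅y⁆] {y = y} {p} x∈τ =
    ∪-lub (τ-extensive (p ∪ ⁅ y ⁆) ∘ p⊆p∪q ⁅ y ⁆) (x∈p⇒⁅x⁆⊆p x∈τ)

  τ-monotone : InclusionReversing S → (A B : Subset n) → A ⊆ B → τ A ⊆ τ B
  τ-monotone reversing A B A⊆B =
    ∪-lub (p⊆p∪q (∁ (S B)) ∘ A⊆B) (q⊆p∪q B (∁ (S B)) ∘ p⊆q⇒∁p⊇∁q (reversing A B A⊆B))

  ∉S[p∪⁅x⁆]⇒∉S : IsShadeMap S → ∀ {x p} → x ∉ p → x ∉ S (p ∪ ⁅ x ⁆) → x ∉ S p
  ∉S[p∪⁅x⁆]⇒∉S shade {x} {p} x∉p x∉S[p∪x] =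
    subst (x ∉_) S[p∪x]≡Sp x∉S[p∪x]
    where
    S[p∪x]≡Sp : S (p ∪ ⁅ x ⁆) ≡ S p
    S[p∪x]≡Sp = trans (sym (proj₂ (shade (p ∪ ⁅ x ⁆) x x∉S[p∪x])))
                      (cong S (x∉p⇒p∪⁅x⁆-x≡p p x x∉p))

  module _ (shade : IsShadeMap S) (reversing : InclusionReversing S) where

    S-constant-on-[F,τF] : ∀ {F B} → F ⊆ B → B ⊆ τ F → S B ≡ S F
    S-constant-on-[F,τF] {F} {B} = go B (⊂-wellFounded B)
      where
      go : ∀ B → Acc _⊂_ B → F ⊆ B → B ⊆ τ F → S B ≡ S F
      go B (acc smaller) F⊆B B⊆τF with any? (λ x → x ∈? B ×-dec ¬? (x ∈? F))
      ... | no ¬∃ = cong S (⊆-antisym B⊆F F⊆B)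
        where
        B⊆F : B ⊆ F
        B⊆F {x} x∈B = decidable-stable (x ∈? F) (λ x∉F → ¬∃ (x , x∈B , x∉F))
      ... | yes (u , u∈B , u∉F) = trans (sym S[B-u]≡SB) S[B-u]≡SF
        where
        u∉SB : u ∉ S B
        u∉SB = ∈τ∧∉⇒∉S (B⊆τF u∈B) u∉F ∘ reversing F B F⊆B
        S[B-u]≡SB : S (B - u) ≡ S B
        S[B-u]≡SB = proj₂ (shade B u u∉SB)
        F⊆B-u : F ⊆ B - u
        F⊆B-u x∈F = x∈p∧x≢y⇒x∈p-y (F⊆B x∈F) λ { refl → u∉F x∈F }
        S[B-u]≡SF : S (B - u) ≡ S F
        S[B-u]≡SF = go (B - u) (smaller (x∈p⇒p-x⊂p u∈B)) F⊆B-u (B⊆τF ∘ p─q⊆p B ⁅ u ⁆)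

    τ-idempotent : (A : Subset n) → τ (τ A) ≡ τ A
    τ-idempotent A = begin
      τ A ∪ ∁ (S (τ A))      ≡⟨ cong (λ s → τ A ∪ ∁ s) (S-constant-on-[F,τF] (τ-extensive A) ⊆-refl) ⟩
      (A ∪ ∁SA) ∪ ∁SA        ≡⟨ ∪-assoc A ∁SA ∁SA ⟩
      A ∪ (∁SA ∪ ∁SA)        ≡⟨ cong (A ∪_) (∪-idem ∁SA) ⟩
      A ∪ ∁SA                ∎
      where
      open ≡-Reasoning
      ∁SA = ∁ (S A)

    S-equal-if-τ-mutually-bounded : ∀ {A B} → B ⊆ τ A → A ⊆ τ B → S A ≡ S B
    S-equal-if-τ-mutually-bounded {A} {B} B⊆τA A⊆τB = begin
      S A        ≡⟨ S-constant-on-[F,τF] (p⊆p∪q B) (∪-lub (τ-extensive A) B⊆τA) ⟨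
      S (A ∪ B)  ≡⟨ S-constant-on-[F,τF] (q⊆p∪q A B) (∪-lub A⊆τB (τ-extensive B)) ⟩
      S B        ∎
      where open ≡-Reasoning

    τ-antimatroidal : IsAntimatroidal τ
    τ-antimatroidal X y z y≢z y∉τX z∉τX z∈τY y∈τZ = z∉τX (∉S⇒∈τ z∉SX)
      where
      z∉Y : z ∉ X ∪ ⁅ y ⁆
      z∉Y z∈Y with x∈p∪q⁻ X ⁅ y ⁆ z∈Y
      ... | inj₁ z∈X    = ∉τ⇒∉ z∉τX z∈X
      ... | inj₂ z∈⁅y⁆ = y≢z (sym (x∈⁅y⁆⇒x≡y y z∈⁅y⁆))
      SY≡SZ : S (X ∪ ⁅ y ⁆) ≡ S (X ∪ ⁅ z ⁆)
      SY≡SZ = S-equal-if-τ-mutually-bounded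
        (x∈τ[p∪⁅y⁆]⇒p∪⁅x⁆⊆τ[p∪⁅y⁆] z∈τY) (x∈τ[p∪⁅y⁆]⇒p∪⁅x⁆⊆τ[p∪⁅y⁆] y∈τZ)
      z∉SX : z ∉ S X
      z∉SX = ∉S[p∪⁅x⁆]⇒∉S shade (∉τ⇒∉ z∉τX) (subst (z ∉_) SY≡SZ (∈τ∧∉⇒∉S z∈τY z∉Y))

proposition4p22 : (n : ℕ) (S : Subset n → Subset n) →
    IsShadeMap S → InclusionReversing S →
    IsQuasiClosure (tauOf S) × IsAntimatroidal (tauOf S)
proposition4p22 n S shade reversing =
  ( τ-extensive S
  , τ-monotone S reversing
  , τ-idempotent S shade reversing )
  , τ-antimatroidal S shade reversing
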